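{- Let $k\ge1$, $n\ge 0$ and $g=(g_1,\ldots,g_k)\in(\mathrm{Int}(\mathbb{Z}^n))^k$, and let $S=g(\mathbb{Z}^n)$. Then there are finitely many $k$-tuples $f^{(1)},\ldots,f^{(N)}$ of polynomials with integer coefficients, $f^{(j)}\in(\mathbb{Z}[y_1,\ldots,y_{n_j}])^k$, such that $S=\bigcup_{j=1}^N f^{(j)}(\mathbb{Z}^{n_j})$.
   Context: $\mathrm{Int}(\mathbb{Z}^n)=\{g\in\mathbb{Q}[x_1,\ldots,x_n]\mid g(a)\in\mathbb{Z}\text{ for all }a\in\mathbb{Z}^n\}$. For a $k$-tuple $f$ of polynomials in $n$ variables, $f(\mathbb{Z}^n)$ is the image of the map obtained by substituting integers for the variables. -}

module Defs where

open import Data.Nat using (ℕ)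
open import Data.Fin using (Fin)
open import Data.Integer as ℤ using (ℤ)
open import Data.Rational as ℚ using (ℚ)
open import Data.Product using (Σ; ∃; _×_)
open import Relation.Binary.PropositionalEquality using (_≡_)

-- Every element of
-- R[x_1,...,x_n] is represented by some expression, and the statement only
-- uses polynomials through their evaluation maps.
data Poly (R : Set) (n : ℕ) : Set where
  con : R → Poly R n
  var : Fin n → Poly R n
  _⊕_ : Poly R n → Poly R n → Poly R n
  _⊗_ : Poly R n → Poly R n → Poly R n

evalℤ : ∀ {n} → Poly ℤ n → (Fin n → ℤ) → ℤ
evalℤ (con c) a = c
evalℤ (var i) a = a i
evalℤ (p ⊕ q) a = evalℤ p a ℤ.+ evalℤ q a
evalℤ (p ⊗ q) a = evalℤ p a ℤ.* evalℤ q a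

ι : ℤ → ℚ
ι z = z ℚ./ 1

evalℚ : ∀ {n} → Poly ℚ n → (Fin n → ℤ) → ℚ
evalℚ (con c) a = c
evalℚ (var i) a = ι (a i)
evalℚ (p ⊕ q) a = evalℚ p a ℚ.+ evalℚ q a
evalℚ (p ⊗ q) a = evalℚ p a ℚ.* evalℚ q a

IntValued : ∀ {n} → Poly ℚ n → Set
IntValued {n} g = (a : Fin n → ℤ) → Σ ℤ λ z → evalℚ g a ≡ ι z

InImageℚ : ∀ {k n} → (Fin k → Poly ℚ n) → (Fin k → ℤ) → Set
InImageℚ {k} {n} g v = Σ (Fin n → ℤ) λ a → (i : Fin k) → evalℚ (g i) a ≡ ι (v i)

InImageℤ : ∀ {k m} → (Fin k → Poly ℤ m) → (Fin k → ℤ) → Set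
InImageℤ {k} {m} f v = Σ (Fin m → ℤ) λ b → (i : Fin k) → evalℤ (f i) b ≡ v i

{-# OPTIONS --safe #-}
-- Write every integer-valued g_i as an integer polynomial divided by a positive
-- integer d_i, and let M be a common multiple of the d_i. On a residue class
-- r + M ℤ^n, Taylor expansion gives numerator(r + M y) = numerator(r) + M h(y)
-- with h integral, and numerator(r) = g_i(r) d_i is divisible by d_i, so
-- g_i(r + M y) = g_i(r) + (M / d_i) h(y) is an integer polynomial in y. The
-- M^n residue classes give the required finite union.
module Submission where

open import Defs
open import Data.Nat as ℕ using (ℕ; suc; _≥_; _^_; NonZero)
open import Data.Nat.Divisibility using (_∣_; divides)
open import Data.Nat.ListAction using (product)
open import Data.Nat.ListAction.Properties using (∈⇒∣product; product≢0)
open import Data.Fin using (Fin; toℕ; fromℕ<; finToFun; funToFin)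
open import Data.Fin.Properties using (toℕ-fromℕ<; finToFun-funToFin)
open import Data.List using (tabulate)
open import Data.List.Membership.Propositional.Properties using (∈-tabulate⁺)
open import Data.List.Relation.Unary.All.Properties using (tabulate⁺)
open import Data.Integer using (ℤ; +_; _+_; _*_)
open import Data.Integer.DivMod using (_/_; _%_; a≡a%n+[a/n]*n; n%d<d)
open import Data.Integer.Properties using (*-comm; *-identityʳ; *-zeroʳ; +-identityʳ; *-cancelʳ-≡; pos-*)
open import Data.Integer.Tactic.RingSolver using (solve-∀)
open import Data.Rational as ℚ using (ℚ; mkℚ; toℚᵘ)
open import Data.Rational.Unnormalised using (mkℚᵘ; _≃_; *≡*)
open import Data.Rational.Unnormalised.Properties using (≃-refl; ≃-sym; ≃-trans; +-cong; *-cong)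
open import Data.Rational.Properties using (toℚᵘ-fromℚᵘ; toℚᵘ-cong; toℚᵘ-injective; toℚᵘ-homo-+; toℚᵘ-homo-*)
open import Data.Product using (Σ; _,_; proj₁; proj₂)
open import Function using (_∘_; const)
open import Function.Bundles using (_⇔_; mk⇔; Equivalence)
open import Relation.Binary.PropositionalEquality using (_≡_; refl; sym; trans; cong; cong₂; module ≡-Reasoning)

open ≡-Reasoning

private
  variable
    n : ℕ

denominator-1 : Poly ℚ n → ℕ
denominator-1 (con c) = ℚ.denominator-1 c
denominator-1 (var i) = 0
denominator-1 (p ⊕ q) = ℕ.pred (suc (denominator-1 p) ℕ.* suc (denominator-1 q))
denominator-1 (p ⊗ q) = ℕ.pred (suc (denominator-1 p) ℕ.* suc (denominator-1 q))

denominator : Poly ℚ n → ℕ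
denominator p = suc (denominator-1 p)

numerator : Poly ℚ n → Poly ℤ n
numerator (con c) = con (ℚ.numerator c)
numerator (var i) = var i
numerator (p ⊕ q) = (numerator p ⊗ con (+ denominator q)) ⊕ (numerator q ⊗ con (+ denominator p))
numerator (p ⊗ q) = numerator p ⊗ numerator q

-- The clauses of numerator and denominator-1 mirror the arithmetic of ℚᵘ, so
-- the inductive steps hold by reflexivity.
toℚᵘ-evalℚ : (p : Poly ℚ n) (a : Fin n → ℤ) →
  toℚᵘ (evalℚ p a) ≃ mkℚᵘ (evalℤ (numerator p) a) (denominator-1 p)
toℚᵘ-evalℚ (con (mkℚ _ _ _)) a = ≃-refl
toℚᵘ-evalℚ (var i) a = toℚᵘ-fromℚᵘ (mkℚᵘ (a i) 0)
toℚᵘ-evalℚ (p ⊕ q) a =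
  ≃-trans (toℚᵘ-homo-+ (evalℚ p a) (evalℚ q a)) (+-cong (toℚᵘ-evalℚ p a) (toℚᵘ-evalℚ q a))
toℚᵘ-evalℚ (p ⊗ q) a =
  ≃-trans (toℚᵘ-homo-* (evalℚ p a) (evalℚ q a)) (*-cong (toℚᵘ-evalℚ p a) (toℚᵘ-evalℚ q a))

evalℚ≡ι⇔evalℤ-numerator≡ : (p : Poly ℚ n) (a : Fin n → ℤ) (w : ℤ) →
  evalℚ p a ≡ ι w ⇔ evalℤ (numerator p) a ≡ w * + denominator p
evalℚ≡ι⇔evalℤ-numerator≡ p a w = mk⇔ to from
  where
  toℚᵘ-ι : toℚᵘ (ι w) ≃ mkℚᵘ w 0
  toℚᵘ-ι = toℚᵘ-fromℚᵘ (mkℚᵘ w 0)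

  to : evalℚ p a ≡ ι w → evalℤ (numerator p) a ≡ w * + denominator p
  to eq with ≃-trans (≃-sym (toℚᵘ-evalℚ p a)) (≃-trans (toℚᵘ-cong eq) toℚᵘ-ι)
  ... | *≡* e = trans (sym (*-identityʳ _)) e

  from : evalℤ (numerator p) a ≡ w * + denominator p → evalℚ p a ≡ ι w
  from e = toℚᵘ-injective
    (≃-trans (toℚᵘ-evalℚ p a) (≃-trans (*≡* (trans (*-identityʳ _) e)) (≃-sym toℚᵘ-ι)))

evalℤ-cong : (h : Poly ℤ n) {a b : Fin n → ℤ} → (∀ t → a t ≡ b t) → evalℤ h a ≡ evalℤ h b
evalℤ-cong (con c) a≗b = refl
evalℤ-cong (var i) a≗b = a≗b i
evalℤ-cong (p ⊕ q) a≗b = cong₂ _+_ (evalℤ-cong p a≗b) (evalℤ-cong q a≗b)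
evalℤ-cong (p ⊗ q) a≗b = cong₂ _*_ (evalℤ-cong p a≗b) (evalℤ-cong q a≗b)

-- dividedShift M r h is the integer polynomial (h(r + M y) - h(r)) / M in y.
dividedShift : ℤ → (Fin n → ℤ) → Poly ℤ n → Poly ℤ n
dividedShift M r (con c) = con (+ 0)
dividedShift M r (var i) = var i
dividedShift M r (p ⊕ q) = dividedShift M r p ⊕ dividedShift M r q
dividedShift M r (p ⊗ q) =
  ((con (evalℤ p r) ⊗ dividedShift M r q) ⊕ (dividedShift M r p ⊗ con (evalℤ q r)))
    ⊕ ((con M ⊗ dividedShift M r p) ⊗ dividedShift M r q)

evalℤ-shift : (M : ℤ) (r y : Fin n → ℤ) (h : Poly ℤ n) →
  evalℤ h (λ t → r t + M * y t) ≡ evalℤ h r + M * evalℤ (dividedShift M r h) y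
evalℤ-shift M r y (con c) = sym (trans (cong (λ x → c + x) (*-zeroʳ M)) (+-identityʳ c))
evalℤ-shift M r y (var i) = refl
evalℤ-shift M r y (p ⊕ q) =
  trans (cong₂ _+_ (evalℤ-shift M r y p) (evalℤ-shift M r y q))
        (sum-shift (evalℤ p r) (evalℤ q r) M (evalℤ (dividedShift M r p) y) (evalℤ (dividedShift M r q) y))
  where
  sum-shift : ∀ A B M x y → (A + M * x) + (B + M * y) ≡ (A + B) + M * (x + y)
  sum-shift = solve-∀
evalℤ-shift M r y (p ⊗ q) =
  trans (cong₂ _*_ (evalℤ-shift M r y p) (evalℤ-shift M r y q))
        (product-shift (evalℤ p r) (evalℤ q r) M (evalℤ (dividedShift M r p) y) (evalℤ (dividedShift M r q) y))
  where
  product-shift : ∀ A B M x y →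
    (A + M * x) * (B + M * y) ≡ A * B + M * ((A * y + x * B) + (M * x) * y)
  product-shift = solve-∀

-- Given g(r) = z ∈ ℤ, this is the integer polynomial y ↦ g(r + M y).
residuePolynomial : (p : Poly ℚ n) {M : ℕ} → denominator p ∣ M → (Fin n → ℤ) → ℤ → Poly ℤ n
residuePolynomial p {M} (divides q _) r z = con z ⊕ (con (+ q) ⊗ dividedShift (+ M) r (numerator p))

evalℚ≡ι⇔evalℤ-residuePolynomial≡ :
  (p : Poly ℚ n) {M : ℕ} (D∣M : denominator p ∣ M) (r : Fin n → ℤ) (z : ℤ) → evalℚ p r ≡ ι z →
  {a y : Fin n → ℤ} → (∀ t → a t ≡ r t + + M * y t) →
  (w : ℤ) → evalℚ p a ≡ ι w ⇔ evalℤ (residuePolynomial p D∣M r z) y ≡ w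
evalℚ≡ι⇔evalℤ-residuePolynomial≡ p {M} D∣M@(divides q M≡qD) r z pr≡z {a} {y} a≗r+My w =
  mk⇔ (λ pa≡w → *-cancelʳ-≡ _ w D (trans (sym numerator-a) (to pa≡w)))
      (λ h≡w → from (trans numerator-a (cong (_* D) h≡w)))
  where
  D : ℤ
  D = + denominator p
  Δ : ℤ
  Δ = evalℤ (dividedShift (+ M) r (numerator p)) y
  open Equivalence (evalℚ≡ι⇔evalℤ-numerator≡ p a w)

  numerator-a : evalℤ (numerator p) a ≡ evalℤ (residuePolynomial p D∣M r z) y * D
  numerator-a = begin
    evalℤ (numerator p) a                       ≡⟨ evalℤ-cong (numerator p) a≗r+My ⟩
    evalℤ (numerator p) (λ t → r t + + M * y t) ≡⟨ evalℤ-shift (+ M) r y (numerator p) ⟩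
    evalℤ (numerator p) r + + M * Δ             ≡⟨ cong₂ (λ u v → u + v * Δ)
                                                     (Equivalence.to (evalℚ≡ι⇔evalℤ-numerator≡ p r z) pr≡z)
                                                     (trans (cong +_ M≡qD) (pos-* q (denominator p))) ⟩
    z * D + (+ q * D) * Δ                       ≡⟨ factor z D (+ q) Δ ⟩
    (z + + q * Δ) * D                           ∎
    where
    factor : ∀ z d c x → z * d + (c * d) * x ≡ (z + c * x) * d
    factor = solve-∀

representative : (M : ℕ) → Fin (M ^ n) → Fin n → ℤ
representative M j t = + toℕ (finToFun j t)

residueClass : (M : ℕ) .{{_ : NonZero M}} → (Fin n → ℤ) → Fin (M ^ n)
residueClass M a = funToFin (λ t → fromℕ< (n%d<d (a t) (+ M)))

a≡representative+M*[a/M] : (M : ℕ) .{{_ : NonZero M}} (a : Fin n → ℤ) (t : Fin n) →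
  a t ≡ representative M (residueClass M a) t + + M * (a t / + M)
a≡representative+M*[a/M] M a t = begin
  a t                                             ≡⟨ a≡a%n+[a/n]*n (a t) (+ M) ⟩
  + (a t % + M) + (a t / + M) * + M               ≡⟨ cong₂ _+_ (cong +_ remainder≡) (*-comm (a t / + M) (+ M)) ⟩
  representative M (residueClass M a) t + + M * (a t / + M) ∎
  where
  remainder≡ : a t % + M ≡ toℕ (finToFun (residueClass M a) t)
  remainder≡ = sym (trans (cong toℕ (finToFun-funToFin _ t)) (toℕ-fromℕ< _))

lemma3 : (k n : ℕ) → k ≥ 1 → (g : Fin k → Poly ℚ n) → ((i : Fin k) → IntValued (g i)) →
    Σ ℕ λ N → Σ (Fin N → ℕ) λ ns → Σ ((j : Fin N) → Fin k → Poly ℤ (ns j)) λ f →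
      (v : Fin k → ℤ) → InImageℚ g v ⇔ Σ (Fin N) (λ j → InImageℤ (f j) v)
lemma3 k n _ g g-int = M ^ n , const n , f , λ v → mk⇔ (to v) (from v)
  where
  M : ℕ
  M = product (tabulate (denominator ∘ g))

  instance
    M≢0 : NonZero M
    M≢0 = product≢0 (tabulate⁺ {f = denominator ∘ g} (λ _ → _))

  denominator∣M : ∀ i → denominator (g i) ∣ M
  denominator∣M i = ∈⇒∣product (∈-tabulate⁺ {f = denominator ∘ g} i)

  r : Fin (M ^ n) → Fin n → ℤ
  r = representative M

  f : Fin (M ^ n) → Fin k → Poly ℤ n
  f j i = residuePolynomial (g i) (denominator∣M i) (r j) (proj₁ (g-int i (r j)))

  onResidueClass : ∀ j i {a y} → (∀ t → a t ≡ r j t + + M * y t) →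
    ∀ w → evalℚ (g i) a ≡ ι w ⇔ evalℤ (f j i) y ≡ w
  onResidueClass j i =
    evalℚ≡ι⇔evalℤ-residuePolynomial≡ (g i) (denominator∣M i) (r j) (proj₁ (g-int i (r j))) (proj₂ (g-int i (r j)))

  to : ∀ v → InImageℚ g v → Σ (Fin (M ^ n)) (λ j → InImageℤ (f j) v)
  to v (a , ga≡v) = residueClass M a , (λ t → a t / + M) , λ i →
    Equivalence.to (onResidueClass _ i (a≡representative+M*[a/M] M a) (v i)) (ga≡v i)

  from : ∀ v → Σ (Fin (M ^ n)) (λ j → InImageℤ (f j) v) → InImageℚ g v
  from v (j , b , fb≡v) = (λ t → r j t + + M * b t) , λ i →
    Equivalence.from (onResidueClass j i (λ _ → refl) (v i)) (fb≡v i)
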